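{- Let $b\geq 2$, $n=b+1$, $V=\{1,\dots,n\}$, and consider the 2-connected $(3,b)$-puzzle given by the cycles $\alpha=(1\ 2\ 3)$ and $\beta=(2\ 3\ \dots\ n)$. Then every even permutation of $V$ can be generated in $O(n^2)$ shifts along $\alpha$ and $\beta$.
   Context: A shift along a cycle $\gamma$ means composing the current permutation with $\gamma$ or $\gamma^{ -1}$. "A permutation can be generated in $N$ shifts" means it is a product of at most $N$ factors, each one of the given cycles or its inverse; the $O(\cdot)$ bound is uniform in $b$ and in the permutation. -}

module Defs where

open import Data.Nat using (ℕ; zero; suc; _+_; _*_; _≤_; s≤s)
import Data.Nat as ℕ
open import Data.Nat.Divisibility using (_∣_)
open import Data.Fin using (Fin; zero; suc; toℕ; fromℕ<; fromℕ; inject₁; _<?_)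
open import Data.Fin.Permutation using (Permutation′; _⟨$⟩ʳ_)
open import Data.List using (List; []; _∷_; length; filter; cartesianProduct; allFin)
open import Data.Product using (_×_; _,_; ∃; Σ-syntax; ∃-syntax)
open import Relation.Nullary using (yes; no)
open import Relation.Nullary.Decidable using (_×-dec_)
open import Relation.Binary.PropositionalEquality using (_≡_)

-- Vertices V = {1,…,n} are modelled by Fin n, vertex v ↦ index v-1.
-- Throughout b = 2 + k (so b ≥ 2) and n = b + 1 = 3 + k.

sucMod : ∀ {m} → Fin (suc m) → Fin (suc m)
sucMod {m} i with toℕ i ℕ.<? m
... | yes p = fromℕ< (s≤s p)
... | no _  = zero

predMod : ∀ {m} → Fin (suc m) → Fin (suc m)
predMod {m} zero    = fromℕ m
predMod     (suc j) = inject₁ j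

α : ∀ k → Fin (3 + k) → Fin (3 + k)
α k zero                = suc zero
α k (suc zero)          = suc (suc zero)
α k (suc (suc zero))    = zero
α k (suc (suc (suc i))) = suc (suc (suc i))

α⁻¹ : ∀ k → Fin (3 + k) → Fin (3 + k)
α⁻¹ k zero                = suc (suc zero)
α⁻¹ k (suc zero)          = zero
α⁻¹ k (suc (suc zero))    = suc zero
α⁻¹ k (suc (suc (suc i))) = suc (suc (suc i))

β : ∀ k → Fin (3 + k) → Fin (3 + k)
β k zero    = zero
β k (suc i) = suc (sucMod i)

β⁻¹ : ∀ k → Fin (3 + k) → Fin (3 + k)
β⁻¹ k zero    = zero
β⁻¹ k (suc i) = suc (predMod i)

data Shift : Set where
  α⁺ α⁻ β⁺ β⁻ : Shift

⟦_⟧ : Shift → ∀ {k} → Fin (3 + k) → Fin (3 + k)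
⟦ α⁺ ⟧ {k} = α k
⟦ α⁻ ⟧ {k} = α⁻¹ k
⟦ β⁺ ⟧ {k} = β k
⟦ β⁻ ⟧ {k} = β⁻¹ k

evalWord : ∀ {k} → List Shift → Fin (3 + k) → Fin (3 + k)
evalWord []       x = x
evalWord (s ∷ ws) x = ⟦ s ⟧ (evalWord ws x)

inversions : ∀ {n} → Permutation′ n → ℕ
inversions {n} σ =
  length (filter (λ { (i , j) → (i <? j) ×-dec ((σ ⟨$⟩ʳ j) <? (σ ⟨$⟩ʳ i)) })
                 (cartesianProduct (allFin n) (allFin n)))

IsEven : ∀ {n} → Permutation′ n → Set
IsEven σ = 2 ∣ inversions σ

GeneratedIn : ∀ k → ℕ → Permutation′ (3 + k) → Set
GeneratedIn k N σ =
  ∃[ ws ] (length ws ≤ N × (∀ x → evalWord {k} ws x ≡ σ ⟨$⟩ʳ x))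

module Submission where

open import Defs
open import Data.Nat using (ℕ; _+_; _*_)
open import Data.Product using (∃-syntax)
open import Data.Fin.Permutation using (Permutation′)

open import Data.Nat using (zero; suc; _≤_; _<_; s≤s; z≤n; s≤s⁻¹)
import Data.Nat.Properties as ℕ
open import Data.Nat.Solver using (module +-*-Solver)
open +-*-Solver using (solve; _:+_; _:*_; _:=_; con)
open import Data.Nat.Divisibility using (_∣_; ∣m+n∣m⇒∣n; ∣m∣n⇒∣m+n; m∣m*n; _∣0; ∣1⇒≡1)
open import Data.Fin using (Fin; zero; suc; toℕ; fromℕ; fromℕ<; inject₁)
open import Data.Fin.Patterns using (0F; 1F; 2F)
import Data.Fin as Fin
open import Data.Fin.Properties
  using (_≟_; _<?_; <-irrefl; <-asym; <-cmp; toℕ-injective; toℕ-fromℕ; toℕ-fromℕ<; toℕ-inject₁; toℕ<n)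
open import Data.Fin.Permutation using (_⟨$⟩ʳ_; permutation; _∘ₚ_)
import Data.Fin.Permutation as Perm
open import Data.List using (List; []; _∷_; _++_; length; filter; map; replicate; tabulate; cartesianProduct; allFin)
open import Data.List.Properties using (filter-++; length-++; length-replicate; map-tabulate)
open import Data.Product using (_×_; _,_; proj₁; proj₂)
open import Data.Sum using (_⊎_; inj₁; inj₂)
open import Function using (_∘_)
open import Function.Bundles using (Injection)
open import Function.Properties.Inverse using (↔⇒↣)
open import Relation.Binary using (tri<; tri≈; tri>)
open import Relation.Binary.PropositionalEquality
  using (_≡_; _≢_; refl; sym; trans; cong; cong₂; subst; ≢-sym; module ≡-Reasoning)
open import Relation.Nullary using (Dec; yes; no; ¬_)
open import Relation.Nullary.Negation using (contradiction)
open import Relation.Nullary.Decidable using (_×-dec_)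
open import Relation.Unary using (Pred; Decidable)
open import Algebra.Properties.Semiring.Sum ℕ.+-*-semiring
  using (sum; sum-syntax; sum-cong-≗; sum-replicate-zero; ∑-distrib-+; ∑-comm; ∑-permute; *-distribˡ-sum)

-- Number the vertices 0, …, n − 1, so that α = (0 1 2) and β = (1 2 … n−1).
-- Conjugating α by βʲ gives (0 j+1 j+2), and (0 j+1 j+2)(0 1 j+1) = (0 1 j+2);
-- hence the word βʲ (α β⁻¹)ʲ α realises (0 1 j+2) in O(j) shifts, and one more
-- conjugation by a power of β realises every 3-cycle (0 x y) in at most 5n shifts.
-- An even σ is then straightened from the top: if σ fixes every point above p, a
-- single 3-cycle through 0 sends σ(p) back to p without moving larger points, and the
-- product stays even since 3-cycles are even (the parity of the inversion count is a
-- homomorphism). After n − 2 steps only 0 and 1 can move, and evenness excludes their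
-- transposition; so σ is a product of at most n − 2 such 3-cycles, i.e. O(n²) shifts.

private variable
  n : ℕ

-- Inversion counts and their parity

permute-injective : (π : Permutation′ n) {i j : Fin n} → π ⟨$⟩ʳ i ≡ π ⟨$⟩ʳ j → i ≡ j
permute-injective π = Injection.injective (↔⇒↣ π)

∑-zero : {f : Fin n → ℕ} → (∀ i → f i ≡ 0) → sum f ≡ 0
∑-zero {n} f≗0 = trans (sum-cong-≗ f≗0) (sum-replicate-zero n)

𝟙 : ∀ {p} {P : Set p} → Dec P → ℕ
𝟙 (yes _) = 1
𝟙 (no _)  = 0

[_<_] : Fin n → Fin n → ℕ
[ i < j ] = 𝟙 (i <? j)

[<]-yes : {i j : Fin n} → i Fin.< j → [ i < j ] ≡ 1
[<]-yes {i = i} {j} i<j with i <? j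
... | yes _   = refl
... | no i≮j = contradiction i<j i≮j

[<]-no : {i j : Fin n} → ¬ i Fin.< j → [ i < j ] ≡ 0
[<]-no {i = i} {j} i≮j with i <? j
... | yes i<j = contradiction i<j i≮j
... | no _    = refl

[<]-irrefl : (i : Fin n) → [ i < i ] ≡ 0
[<]-irrefl i = [<]-no (<-irrefl refl)

[<]-asym : (i j : Fin n) → [ i < j ] * [ j < i ] ≡ 0
[<]-asym i j with i <? j
... | no _    = refl
... | yes i<j rewrite [<]-no (<-asym i<j) = refl

inversionSum : (Fin n → Fin n) → ℕ
inversionSum {n} f = ∑[ i < n ] ∑[ j < n ] ([ i < j ] * [ f j < f i ])

inversionSum-cong : {f g : Fin n → Fin n} → (∀ i → f i ≡ g i) → inversionSum f ≡ inversionSum g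
inversionSum-cong f≗g =
  sum-cong-≗ λ i → sum-cong-≗ λ j → cong₂ (λ a b → [ i < j ] * [ a < b ]) (f≗g j) (f≗g i)

inversionSum-id : ∀ {n} → inversionSum {n} (λ i → i) ≡ 0
inversionSum-id {n} = ∑-zero {n} λ i → ∑-zero λ j → [<]-asym i j

module _ {A B : Set} {p} {P : Pred (A × B) p} (P? : Decidable P) where

  length-filter-tabulate : ∀ {m} (h : Fin m → A × B) →
                           length (filter P? (tabulate h)) ≡ ∑[ i < m ] 𝟙 (P? (h i))
  length-filter-tabulate {zero}  h = refl
  length-filter-tabulate {suc m} h with P? (h zero)
  ... | yes _ = cong suc (length-filter-tabulate (h ∘ suc))
  ... | no _  = length-filter-tabulate (h ∘ suc)

  length-filter-cartesianProduct : ∀ {m} (h : Fin m → A) (ys : List B) →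
    length (filter P? (cartesianProduct (tabulate h) ys)) ≡ ∑[ i < m ] length (filter P? (map (h i ,_) ys))
  length-filter-cartesianProduct {zero}  h ys = refl
  length-filter-cartesianProduct {suc m} h ys = begin
    length (filter P? (map (h zero ,_) ys ++ rest))                 ≡⟨ cong length (filter-++ P? (map (h zero ,_) ys) rest) ⟩
    length (filter P? (map (h zero ,_) ys) ++ filter P? rest)        ≡⟨ length-++ (filter P? (map (h zero ,_) ys)) ⟩
    length (filter P? (map (h zero ,_) ys)) + length (filter P? rest) ≡⟨ cong (length (filter P? (map (h zero ,_) ys)) +_)
                                                                              (length-filter-cartesianProduct (h ∘ suc) ys) ⟩
    ∑[ i < suc m ] length (filter P? (map (h i ,_) ys)) ∎
    where
    open ≡-Reasoning
    rest = cartesianProduct (tabulate (h ∘ suc)) ys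

length-filter-allPairs : ∀ {p} {P : Pred (Fin n × Fin n) p} (P? : Decidable P) →
  length (filter P? (cartesianProduct (allFin n) (allFin n))) ≡ ∑[ i < n ] ∑[ j < n ] 𝟙 (P? (i , j))
length-filter-allPairs {n} P? = trans (length-filter-cartesianProduct P? (λ i → i) (allFin n)) (sum-cong-≗ λ i →
  trans (cong (length ∘ filter P?) (map-tabulate (λ j → j) (i ,_))) (length-filter-tabulate P? (i ,_)))

𝟙-×-dec : ∀ {p q} {P : Set p} {Q : Set q} (p? : Dec P) (q? : Dec Q) → 𝟙 (p? ×-dec q?) ≡ 𝟙 p? * 𝟙 q?
𝟙-×-dec (yes _) (yes _) = refl
𝟙-×-dec (yes _) (no _)  = refl
𝟙-×-dec (no _)  _       = refl

inversions≡inversionSum : (σ : Permutation′ n) → inversions σ ≡ inversionSum (σ ⟨$⟩ʳ_)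
inversions≡inversionSum {n} σ = trans (length-filter-allPairs {n} _)
  (sum-cong-≗ λ i → sum-cong-≗ λ j → 𝟙-×-dec (i <? j) (σ ⟨$⟩ʳ j <? σ ⟨$⟩ʳ i))

∑∑-distrib-+ : (F G : Fin n → Fin n → ℕ) →
  ∑[ i < n ] ∑[ j < n ] (F i j + G i j) ≡ ∑[ i < n ] ∑[ j < n ] F i j + ∑[ i < n ] ∑[ j < n ] G i j
∑∑-distrib-+ {n} F G = trans (sum-cong-≗ λ i → ∑-distrib-+ (F i) (G i)) (∑-distrib-+ (λ i → sum (F i)) (λ i → sum (G i)))

∑∑-*-distribˡ : ∀ c (F : Fin n → Fin n → ℕ) → c * ∑[ i < n ] ∑[ j < n ] F i j ≡ ∑[ i < n ] ∑[ j < n ] (c * F i j)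
∑∑-*-distribˡ c F = trans (*-distribˡ-sum c (λ i → sum (F i))) (sum-cong-≗ λ i → *-distribˡ-sum c (F i))

∑∑-permute : (π : Permutation′ n) (F : Fin n → Fin n → ℕ) →
  ∑[ i < n ] ∑[ j < n ] F (π ⟨$⟩ʳ i) (π ⟨$⟩ʳ j) ≡ ∑[ i < n ] ∑[ j < n ] F i j
∑∑-permute π F = trans (sum-cong-≗ λ i → sym (∑-permute (F (π ⟨$⟩ʳ i)) π)) (sym (∑-permute (λ i → sum (F i)) π))

-- Each unordered pair {i, j} of a symmetric Z is counted twice: once with i < j and once with j < i.
∑∑-symmetric : (Z : Fin n → Fin n → ℕ) → (∀ i → Z i i ≡ 0) → (∀ i j → Z i j ≡ Z j i) →
  ∑[ i < n ] ∑[ j < n ] Z i j ≡ 2 * ∑[ i < n ] ∑[ j < n ] ([ i < j ] * Z i j)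
∑∑-symmetric {n} Z Zᵢᵢ≡0 Z-sym = begin
  ∑[ i < n ] ∑[ j < n ] Z i j                                    ≡⟨ sum-cong-≗ (λ i → sum-cong-≗ (split i)) ⟩
  ∑[ i < n ] ∑[ j < n ] ([ i < j ] * Z i j + [ j < i ] * Z i j)   ≡⟨ ∑∑-distrib-+ Zᵤ (λ i j → [ j < i ] * Z i j) ⟩
  U + ∑[ i < n ] ∑[ j < n ] ([ j < i ] * Z i j)                   ≡⟨ cong (U +_) (∑-comm (λ i j → [ j < i ] * Z i j)) ⟩
  U + ∑[ j < n ] ∑[ i < n ] ([ j < i ] * Z i j)                   ≡⟨ cong (U +_) (sum-cong-≗ λ j → sum-cong-≗ λ i → cong ([ j < i ] *_) (Z-sym i j)) ⟩
  U + U                                                          ≡⟨ cong (U +_) (sym (ℕ.+-identityʳ U)) ⟩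
  2 * U                                                          ∎
  where
  open ≡-Reasoning
  Zᵤ = λ i j → [ i < j ] * Z i j
  U = ∑[ i < n ] ∑[ j < n ] Zᵤ i j
  split : ∀ i j → Z i j ≡ [ i < j ] * Z i j + [ j < i ] * Z i j
  split i j with <-cmp i j
  ... | tri< i<j _ j≮i rewrite [<]-yes i<j | [<]-no j≮i =
    sym (trans (cong₂ _+_ (ℕ.+-identityʳ (Z i j)) (ℕ.*-zeroˡ (Z i j))) (ℕ.+-identityʳ (Z i j)))
  ... | tri≈ _ refl _  rewrite Zᵢᵢ≡0 i | [<]-irrefl i = refl
  ... | tri> i≮j _ j<i rewrite [<]-no i≮j | [<]-yes j<i = sym (ℕ.+-identityʳ (Z i j))

xor : ℕ → ℕ → ℕ
xor zero    b       = b
xor (suc _) zero    = 1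
xor (suc _) (suc _) = 0

𝟙-+ : ∀ {c p q} {C : Set c} {P : Set p} {Q : Set q} (c? : Dec C) (p? : Dec P) (q? : Dec Q) →
      𝟙 c? * 𝟙 q? + 𝟙 c? * 𝟙 p? ≡ 𝟙 c? * xor (𝟙 p?) (𝟙 q?) + 2 * (𝟙 c? * (𝟙 p? * 𝟙 q?))
𝟙-+ (yes _) (yes _) (yes _) = refl
𝟙-+ (yes _) (yes _) (no _)  = refl
𝟙-+ (yes _) (no _)  (yes _) = refl
𝟙-+ (yes _) (no _)  (no _)  = refl
𝟙-+ (no _)  _       _       = refl

module _ (π ρ : Permutation′ n) where
  private
    f g : Fin n → Fin n
    f = π ⟨$⟩ʳ_
    g = ρ ⟨$⟩ʳ_

    discordant : Fin n → Fin n → ℕ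
    discordant u v = xor [ v < u ] [ g v < g u ]

    discordant-irrefl : ∀ u → discordant u u ≡ 0
    discordant-irrefl u rewrite [<]-irrefl u | [<]-irrefl (g u) = refl

    discordant-sym : ∀ u v → discordant u v ≡ discordant v u
    discordant-sym u v with <-cmp u v | <-cmp (g u) (g v)
    ... | tri≈ _ refl _  | _ = refl
    ... | tri< _ u≢v _   | tri≈ _ gu≡gv _ = contradiction (permute-injective ρ gu≡gv) u≢v
    ... | tri> _ u≢v _   | tri≈ _ gu≡gv _ = contradiction (permute-injective ρ gu≡gv) u≢v
    ... | tri< u<v _ v≮u | tri< gu<gv _ gv≮gu rewrite [<]-no v≮u | [<]-yes u<v | [<]-no gv≮gu | [<]-yes gu<gv = refl
    ... | tri< u<v _ v≮u | tri> gu≮gv _ gv<gu rewrite [<]-no v≮u | [<]-yes u<v | [<]-no gu≮gv | [<]-yes gv<gu = refl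
    ... | tri> u≮v _ v<u | tri< gu<gv _ gv≮gu rewrite [<]-no u≮v | [<]-yes v<u | [<]-no gv≮gu | [<]-yes gu<gv = refl
    ... | tri> u≮v _ v<u | tri> gu≮gv _ gv<gu rewrite [<]-no u≮v | [<]-yes v<u | [<]-no gu≮gv | [<]-yes gv<gu = refl

    discordant-ordered : ∀ u v → [ u < v ] * discordant u v ≡ [ u < v ] * [ g v < g u ]
    discordant-ordered u v with u <? v
    ... | no _    = refl
    ... | yes u<v rewrite [<]-no (<-asym u<v) = refl

    D = ∑[ i < n ] ∑[ j < n ] ([ i < j ] * discordant (f i) (f j))
    W = ∑[ i < n ] ∑[ j < n ] ([ i < j ] * ([ f j < f i ] * [ g (f j) < g (f i) ]))

    inversionSum-∘-split : inversionSum (g ∘ f) + inversionSum f ≡ D + 2 * W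
    inversionSum-∘-split = begin
      inversionSum (g ∘ f) + inversionSum f
        ≡⟨ sym (∑∑-distrib-+ (λ i j → [ i < j ] * [ g (f j) < g (f i) ]) (λ i j → [ i < j ] * [ f j < f i ])) ⟩
      ∑[ i < n ] ∑[ j < n ] ([ i < j ] * [ g (f j) < g (f i) ] + [ i < j ] * [ f j < f i ])
        ≡⟨ sum-cong-≗ (λ i → sum-cong-≗ λ j → 𝟙-+ (i <? j) (f j <? f i) (g (f j) <? g (f i))) ⟩
      ∑[ i < n ] ∑[ j < n ] ([ i < j ] * discordant (f i) (f j) + 2 * ([ i < j ] * ([ f j < f i ] * [ g (f j) < g (f i) ])))
        ≡⟨ ∑∑-distrib-+ (λ i j → [ i < j ] * discordant (f i) (f j)) _ ⟩
      D + ∑[ i < n ] ∑[ j < n ] (2 * ([ i < j ] * ([ f j < f i ] * [ g (f j) < g (f i) ])))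
        ≡⟨ cong (D +_) (sym (∑∑-*-distribˡ 2 (λ i j → [ i < j ] * ([ f j < f i ] * [ g (f j) < g (f i) ])))) ⟩
      D + 2 * W ∎
      where open ≡-Reasoning

    -- D does not depend on f, since f only relabels the pairs being compared.
    D≡inversionSum : D ≡ inversionSum g
    D≡inversionSum = ℕ.*-cancelˡ-≡ D (inversionSum g) 2 (begin
      2 * D                                                  ≡⟨ sym (∑∑-symmetric (λ i j → discordant (f i) (f j)) (discordant-irrefl ∘ f) (λ i j → discordant-sym (f i) (f j))) ⟩
      ∑[ i < n ] ∑[ j < n ] discordant (f i) (f j)            ≡⟨ ∑∑-permute π discordant ⟩
      ∑[ u < n ] ∑[ v < n ] discordant u v                    ≡⟨ ∑∑-symmetric discordant discordant-irrefl discordant-sym ⟩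
      2 * ∑[ u < n ] ∑[ v < n ] ([ u < v ] * discordant u v)  ≡⟨ cong (2 *_) (sum-cong-≗ λ u → sum-cong-≗ (discordant-ordered u)) ⟩
      2 * inversionSum g                                     ∎)
      where open ≡-Reasoning

  inversionSum-∘ₚ : ∃[ w ] (inversionSum (π ⟨$⟩ʳ_) + inversionSum ((π ∘ₚ ρ) ⟨$⟩ʳ_) ≡ 2 * w + inversionSum (ρ ⟨$⟩ʳ_))
  inversionSum-∘ₚ = W , (begin
    inversionSum f + inversionSum (g ∘ f) ≡⟨ ℕ.+-comm (inversionSum f) (inversionSum (g ∘ f)) ⟩
    inversionSum (g ∘ f) + inversionSum f ≡⟨ inversionSum-∘-split ⟩
    D + 2 * W                             ≡⟨ cong (_+ 2 * W) D≡inversionSum ⟩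
    inversionSum g + 2 * W                ≡⟨ ℕ.+-comm (inversionSum g) (2 * W) ⟩
    2 * W + inversionSum g                ∎)
    where open ≡-Reasoning

IsEven-∘ₚ : (π ρ : Permutation′ n) → IsEven π → IsEven ρ → IsEven (π ∘ₚ ρ)
IsEven-∘ₚ π ρ 2∣π 2∣ρ
  rewrite inversions≡inversionSum π | inversions≡inversionSum ρ | inversions≡inversionSum (π ∘ₚ ρ)
  with w , eq ← inversionSum-∘ₚ π ρ
  = ∣m+n∣m⇒∣n (subst (2 ∣_) (sym eq) (∣m∣n⇒∣m+n (m∣m*n w) 2∣ρ)) 2∣π

IsEven-cancelˡ : (π ρ : Permutation′ n) → IsEven π → IsEven (π ∘ₚ ρ) → IsEven ρ
IsEven-cancelˡ π ρ 2∣π 2∣πρ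
  rewrite inversions≡inversionSum π | inversions≡inversionSum ρ | inversions≡inversionSum (π ∘ₚ ρ)
  with w , eq ← inversionSum-∘ₚ π ρ
  = ∣m+n∣m⇒∣n (subst (2 ∣_) eq (∣m∣n⇒∣m+n 2∣π 2∣πρ)) (m∣m*n w)

IsEven-square : (τ : Permutation′ n) → IsEven (τ ∘ₚ τ)
IsEven-square τ
  rewrite inversions≡inversionSum (τ ∘ₚ τ)
  with w , eq ← inversionSum-∘ₚ τ τ
  = subst (2 ∣_) (sym (ℕ.+-cancelˡ-≡ (inversionSum (τ ⟨$⟩ʳ_)) _ _ (trans eq (ℕ.+-comm (2 * w) _)))) (m∣m*n w)

IsEven-cube≡id : (τ : Permutation′ n) → (∀ i → τ ⟨$⟩ʳ (τ ⟨$⟩ʳ (τ ⟨$⟩ʳ i)) ≡ i) → IsEven τ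
IsEven-cube≡id {n} τ τ³≗id = IsEven-cancelˡ (τ ∘ₚ τ) τ (IsEven-square τ) 2∣τ³
  where
  2∣τ³ : IsEven ((τ ∘ₚ τ) ∘ₚ τ)
  2∣τ³ rewrite inversions≡inversionSum ((τ ∘ₚ τ) ∘ₚ τ) | inversionSum-cong τ³≗id | inversionSum-id {n} = 2 ∣0

swap01 : ∀ {m} → Fin (2 + m) → Fin (2 + m)
swap01 0F            = 1F
swap01 1F            = 0F
swap01 (suc (suc i)) = suc (suc i)

-- The double sum unfolds definitionally: only the pair (0, 1) contributes, the entries
-- pairing 0 or 1 with a larger point vanish by computation, and the rest by [<]-asym.
inversionSum-swap01 : ∀ m → inversionSum (swap01 {m}) ≡ 1
inversionSum-swap01 m = cong suc (cong₂ _+_ (∑-zero {m} λ _ → refl) (cong₂ _+_ (∑-zero {m} λ _ → refl)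
  (∑-zero {m} λ i → ∑-zero {m} λ j → [<]-asym (suc (suc i)) (suc (suc j)))))

-- Permutations fixing every large point

FixesFrom : (Fin n → Fin n) → ℕ → Set
FixesFrom f m = ∀ i → m ≤ toℕ i → f i ≡ i

FixesFrom-< : ∀ {m} (σ : Permutation′ n) → FixesFrom (σ ⟨$⟩ʳ_) m → ∀ {i} → toℕ i < m → toℕ (σ ⟨$⟩ʳ i) < m
FixesFrom-< {m = m} σ fix {i} i<m with m ℕ.≤? toℕ (σ ⟨$⟩ʳ i)
... | yes m≤σi = contradiction (subst (λ j → m ≤ toℕ j) (permute-injective σ (fix _ m≤σi)) m≤σi) (ℕ.<⇒≱ i<m)
... | no  m≰σi = ℕ.≰⇒> m≰σi

FixesFrom-extend : ∀ {m} {f : Fin n → Fin n} → FixesFrom f (suc m) → (∀ i → toℕ i ≡ m → f i ≡ i) → FixesFrom f m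
FixesFrom-extend fix fix-m i m≤i with ℕ.m≤n⇒m<n∨m≡n m≤i
... | inj₁ m<i = fix i m<i
... | inj₂ m≡i = fix-m i (sym m≡i)

toℕ<2⇒0∨1 : ∀ {m} (i : Fin (2 + m)) → toℕ i < 2 → i ≡ 0F ⊎ i ≡ 1F
toℕ<2⇒0∨1 0F            _                = inj₁ refl
toℕ<2⇒0∨1 1F            _                = inj₂ refl
toℕ<2⇒0∨1 (suc (suc _)) (s≤s (s≤s ()))

IsEven-FixesFrom-2⇒id : ∀ {m} (σ : Permutation′ (2 + m)) → FixesFrom (σ ⟨$⟩ʳ_) 2 → IsEven σ → ∀ i → σ ⟨$⟩ʳ i ≡ i
IsEven-FixesFrom-2⇒id {m} σ fix even = λ
  { 0F            → proj₁ fixes01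
  ; 1F            → proj₂ fixes01
  ; (suc (suc i)) → fix (suc (suc i)) (s≤s (s≤s z≤n))
  }
  where
  fixes01 : σ ⟨$⟩ʳ 0F ≡ 0F × σ ⟨$⟩ʳ 1F ≡ 1F
  fixes01 with toℕ<2⇒0∨1 (σ ⟨$⟩ʳ 0F) (FixesFrom-< σ fix (s≤s z≤n)) | toℕ<2⇒0∨1 (σ ⟨$⟩ʳ 1F) (FixesFrom-< σ fix (s≤s (s≤s z≤n)))
  ... | inj₁ σ0≡0 | inj₂ σ1≡1 = σ0≡0 , σ1≡1
  ... | inj₁ σ0≡0 | inj₁ σ1≡0 = contradiction (permute-injective σ (trans σ0≡0 (sym σ1≡0))) λ ()
  ... | inj₂ σ0≡1 | inj₂ σ1≡1 = contradiction (permute-injective σ (trans σ0≡1 (sym σ1≡1))) λ ()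
  ... | inj₂ σ0≡1 | inj₁ σ1≡0 = contradiction (∣1⇒≡1 (subst (2 ∣_) odd even)) λ ()
    where
    σ≗swap01 : ∀ i → σ ⟨$⟩ʳ i ≡ swap01 i
    σ≗swap01 0F            = σ0≡1
    σ≗swap01 1F            = σ1≡0
    σ≗swap01 (suc (suc i)) = fix (suc (suc i)) (s≤s (s≤s z≤n))
    odd : inversions σ ≡ 1
    odd = trans (inversions≡inversionSum σ) (trans (inversionSum-cong σ≗swap01) (inversionSum-swap01 m))

-- 3-cycles

cycle3 : Fin n → Fin n → Fin n → Fin n → Fin n
cycle3 a b c z with z ≟ a | z ≟ b | z ≟ c
... | yes _ | _     | _     = b
... | no _  | yes _ | _     = c
... | no _  | no _  | yes _ = a
... | no _  | no _  | no _  = z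

data Cycle3View (a b c : Fin n) : Fin n → Set where
  at-a      : Cycle3View a b c a
  at-b      : Cycle3View a b c b
  at-c      : Cycle3View a b c c
  elsewhere : ∀ {z} → z ≢ a → z ≢ b → z ≢ c → Cycle3View a b c z

cycle3-view : (a b c z : Fin n) → Cycle3View a b c z
cycle3-view a b c z with z ≟ a | z ≟ b | z ≟ c
... | yes refl | _        | _        = at-a
... | no _     | yes refl | _        = at-b
... | no _     | no _     | yes refl = at-c
... | no z≢a   | no z≢b   | no z≢c   = elsewhere z≢a z≢b z≢c

cycle3-fix : {a b c z : Fin n} → z ≢ a → z ≢ b → z ≢ c → cycle3 a b c z ≡ z
cycle3-fix {a = a} {b} {c} {z} z≢a z≢b z≢c with z ≟ a | z ≟ b | z ≟ c
... | yes z≡a | _     | _     = contradiction z≡a z≢a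
... | no _  | yes z≡b | _     = contradiction z≡b z≢b
... | no _  | no _  | yes z≡c = contradiction z≡c z≢c
... | no _  | no _  | no _    = refl

module _ {a b c : Fin n} (a≢b : a ≢ b) (a≢c : a ≢ c) (b≢c : b ≢ c) where

  cycle3-a : cycle3 a b c a ≡ b
  cycle3-a with a ≟ a
  ... | yes _   = refl
  ... | no a≢a = contradiction refl a≢a

  cycle3-b : cycle3 a b c b ≡ c
  cycle3-b with b ≟ a | b ≟ b
  ... | yes b≡a | _       = contradiction (sym b≡a) a≢b
  ... | no _    | yes _   = refl
  ... | no _    | no b≢b = contradiction refl b≢b

  cycle3-c : cycle3 a b c c ≡ a
  cycle3-c with c ≟ a | c ≟ b | c ≟ c
  ... | yes c≡a | _       | _       = contradiction (sym c≡a) a≢c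
  ... | no _    | yes c≡b | _       = contradiction (sym c≡b) b≢c
  ... | no _    | no _    | yes _   = refl
  ... | no _    | no _    | no c≢c = contradiction refl c≢c

module _ {a b c : Fin n} (a≢b : a ≢ b) (a≢c : a ≢ c) (b≢c : b ≢ c) where

  cycle3-inverse : ∀ z → cycle3 a c b (cycle3 a b c z) ≡ z
  cycle3-inverse z with cycle3-view a b c z
  ... | at-a rewrite cycle3-a a≢b a≢c b≢c = cycle3-c a≢c a≢b (≢-sym b≢c)
  ... | at-b rewrite cycle3-b a≢b a≢c b≢c = cycle3-b a≢c a≢b (≢-sym b≢c)
  ... | at-c rewrite cycle3-c a≢b a≢c b≢c = cycle3-a a≢c a≢b (≢-sym b≢c)
  ... | elsewhere z≢a z≢b z≢c rewrite cycle3-fix z≢a z≢b z≢c = cycle3-fix z≢a z≢c z≢b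

  cycle3-cube : ∀ z → cycle3 a b c (cycle3 a b c (cycle3 a b c z)) ≡ z
  cycle3-cube z with cycle3-view a b c z
  ... | at-a rewrite cycle3-a a≢b a≢c b≢c | cycle3-b a≢b a≢c b≢c = cycle3-c a≢b a≢c b≢c
  ... | at-b rewrite cycle3-b a≢b a≢c b≢c | cycle3-c a≢b a≢c b≢c = cycle3-a a≢b a≢c b≢c
  ... | at-c rewrite cycle3-c a≢b a≢c b≢c | cycle3-a a≢b a≢c b≢c = cycle3-b a≢b a≢c b≢c
  ... | elsewhere z≢a z≢b z≢c rewrite cycle3-fix z≢a z≢b z≢c | cycle3-fix z≢a z≢b z≢c = cycle3-fix z≢a z≢b z≢c

  cycle3-map : (h : Fin n → Fin n) → (∀ {x y} → h x ≡ h y → x ≡ y) →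
               ∀ z → h (cycle3 a b c z) ≡ cycle3 (h a) (h b) (h c) (h z)
  cycle3-map h h-inj z with cycle3-view a b c z
  ... | at-a rewrite cycle3-a a≢b a≢c b≢c = sym (cycle3-a (a≢b ∘ h-inj) (a≢c ∘ h-inj) (b≢c ∘ h-inj))
  ... | at-b rewrite cycle3-b a≢b a≢c b≢c = sym (cycle3-b (a≢b ∘ h-inj) (a≢c ∘ h-inj) (b≢c ∘ h-inj))
  ... | at-c rewrite cycle3-c a≢b a≢c b≢c = sym (cycle3-c (a≢b ∘ h-inj) (a≢c ∘ h-inj) (b≢c ∘ h-inj))
  ... | elsewhere z≢a z≢b z≢c rewrite cycle3-fix z≢a z≢b z≢c =
    sym (cycle3-fix (z≢a ∘ h-inj) (z≢b ∘ h-inj) (z≢c ∘ h-inj))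

cycle3ₚ : {a b c : Fin n} → a ≢ b → a ≢ c → b ≢ c → Permutation′ n
cycle3ₚ {a = a} {b} {c} a≢b a≢c b≢c = permutation (cycle3 a b c) (cycle3 a c b)
  (cycle3-inverse a≢c a≢b (≢-sym b≢c)) (cycle3-inverse a≢b a≢c b≢c)

cycle3-∘ : {a b c d : Fin n} → a ≢ b → a ≢ c → a ≢ d → b ≢ c → b ≢ d → c ≢ d →
           ∀ z → cycle3 a c d (cycle3 a b c z) ≡ cycle3 a b d z
cycle3-∘ {a = a} {b} {c} {d} a≢b a≢c a≢d b≢c b≢d c≢d z with cycle3-view a b c z
... | at-a rewrite cycle3-a a≢b a≢c b≢c | cycle3-a a≢b a≢d b≢d = cycle3-fix (≢-sym a≢b) b≢c b≢d
... | at-b rewrite cycle3-b a≢b a≢c b≢c | cycle3-b a≢b a≢d b≢d = cycle3-b a≢c a≢d c≢d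
... | at-c rewrite cycle3-c a≢b a≢c b≢c | cycle3-fix (≢-sym a≢c) (≢-sym b≢c) c≢d = cycle3-a a≢c a≢d c≢d
... | elsewhere z≢a z≢b z≢c rewrite cycle3-fix z≢a z≢b z≢c with cycle3-view a b d z
...   | at-a                 = contradiction refl z≢a
...   | at-b                 = contradiction refl z≢b
...   | at-c                 = trans (cycle3-c a≢c a≢d c≢d) (sym (cycle3-c a≢b a≢d b≢d))
...   | elsewhere _ _ z≢d    = trans (cycle3-fix z≢a z≢c z≢d) (sym (cycle3-fix z≢a z≢b z≢d))

-- Words in the shifts

toℕ-sucMod : ∀ {m} (i : Fin (suc m)) → toℕ i < m → toℕ (sucMod i) ≡ suc (toℕ i)
toℕ-sucMod {m} i i<m with toℕ i ℕ.<? m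
... | yes i<m′ = toℕ-fromℕ< (s≤s i<m′)
... | no  i≮m  = contradiction i<m i≮m

predMod-sucMod : ∀ {m} (i : Fin (suc m)) → predMod (sucMod i) ≡ i
predMod-sucMod {m} i with toℕ i ℕ.<? m
... | yes i<m = toℕ-injective (trans (toℕ-inject₁ (fromℕ< i<m)) (toℕ-fromℕ< i<m))
... | no  i≮m = toℕ-injective (trans (toℕ-fromℕ m) (sym (ℕ.≤∧≮⇒≡ (s≤s⁻¹ (toℕ<n i)) i≮m)))

sucMod-predMod : ∀ {m} (i : Fin (suc m)) → sucMod (predMod i) ≡ i
sucMod-predMod {m} zero with toℕ (fromℕ m) ℕ.<? m
... | yes m<m = contradiction (subst (_< m) (toℕ-fromℕ m) m<m) (ℕ.<-irrefl refl)
... | no  _   = refl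
sucMod-predMod {m} (suc j) with toℕ (inject₁ j) ℕ.<? m
... | yes j<m = toℕ-injective (cong suc (trans (toℕ-fromℕ< j<m) (toℕ-inject₁ j)))
... | no  j≮m = contradiction (subst (_< m) (sym (toℕ-inject₁ j)) (toℕ<n j)) j≮m

β⁻¹-β : ∀ k (x : Fin (3 + k)) → β⁻¹ k (β k x) ≡ x
β⁻¹-β k zero    = refl
β⁻¹-β k (suc x) = cong suc (predMod-sucMod x)

β-β⁻¹ : ∀ k (x : Fin (3 + k)) → β k (β⁻¹ k x) ≡ x
β-β⁻¹ k zero    = refl
β-β⁻¹ k (suc x) = cong suc (sucMod-predMod x)

α≗cycle3 : ∀ k (z : Fin (3 + k)) → α k z ≡ cycle3 0F 1F 2F z
α≗cycle3 k 0F                  = refl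
α≗cycle3 k 1F                  = refl
α≗cycle3 k 2F                  = refl
α≗cycle3 k (suc (suc (suc z))) = refl

evalWord-++ : ∀ {k} ws vs (x : Fin (3 + k)) → evalWord (ws ++ vs) x ≡ evalWord ws (evalWord vs x)
evalWord-++ []       vs x = refl
evalWord-++ {k} (s ∷ ws) vs x = cong (⟦ s ⟧ {k}) (evalWord-++ ws vs x)

evalWord-replicate-comm : ∀ {k} s t (x : Fin (3 + k)) →
  evalWord (replicate t s) (⟦ s ⟧ x) ≡ ⟦ s ⟧ (evalWord (replicate t s) x)
evalWord-replicate-comm s zero    x = refl
evalWord-replicate-comm {k} s (suc t) x = cong (⟦ s ⟧ {k}) (evalWord-replicate-comm s t x)

evalWord-replicate-inverse : ∀ {k s s′} → (∀ (x : Fin (3 + k)) → ⟦ s′ ⟧ (⟦ s ⟧ x) ≡ x) →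
  ∀ t x → evalWord (replicate t s′) (evalWord (replicate t s) x) ≡ x
evalWord-replicate-inverse         s′∘s≗id zero    x = refl
evalWord-replicate-inverse {k} {s} {s′} s′∘s≗id (suc t) x = begin
  ⟦ s′ ⟧ (evalWord (replicate t s′) (⟦ s ⟧ y)) ≡⟨ evalWord-replicate-comm s′ t (⟦ s ⟧ y) ⟨
  evalWord (replicate t s′) (⟦ s′ ⟧ (⟦ s ⟧ y)) ≡⟨ cong (evalWord (replicate t s′)) (s′∘s≗id y) ⟩
  evalWord (replicate t s′) y                  ≡⟨ evalWord-replicate-inverse s′∘s≗id t x ⟩
  x                                            ∎
  where
  open ≡-Reasoning
  y = evalWord {k} (replicate t s) x

≢-by-toℕ : {x y : Fin n} → toℕ x ≢ toℕ y → x ≢ y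
≢-by-toℕ toℕx≢toℕy = toℕx≢toℕy ∘ cong toℕ

β⁺^ β⁻^ : ℕ → List Shift
β⁺^ t = replicate t β⁺
β⁻^ t = replicate t β⁻

module _ {k : ℕ} where

  β⁻^-β⁺^ : ∀ t (x : Fin (3 + k)) → evalWord (β⁻^ t) (evalWord (β⁺^ t) x) ≡ x
  β⁻^-β⁺^ = evalWord-replicate-inverse (β⁻¹-β k)

  β⁺^-β⁻^ : ∀ t (x : Fin (3 + k)) → evalWord (β⁺^ t) (evalWord (β⁻^ t) x) ≡ x
  β⁺^-β⁻^ = evalWord-replicate-inverse (β-β⁻¹ k)

  β⁺^-0 : ∀ t → evalWord {k} (β⁺^ t) 0F ≡ 0F
  β⁺^-0 zero                    = refl
  β⁺^-0 (suc t) rewrite β⁺^-0 t = refl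

  toℕ-β : (x : Fin (3 + k)) → 1 ≤ toℕ x → toℕ x ≤ suc k → toℕ (β k x) ≡ suc (toℕ x)
  toℕ-β (suc x) _ x≤k = cong suc (toℕ-sucMod x x≤k)

  toℕ-β⁺^-1 : ∀ t → t ≤ suc k → toℕ (evalWord {k} (β⁺^ t) 1F) ≡ suc t
  toℕ-β⁺^-1 zero    _   = refl
  toℕ-β⁺^-1 (suc t) t<1+k = begin
    toℕ (β k (evalWord (β⁺^ t) 1F)) ≡⟨ toℕ-β _ (subst (1 ≤_) (sym IH) (s≤s z≤n)) (subst (_≤ suc k) (sym IH) t<1+k) ⟩
    suc (toℕ (evalWord (β⁺^ t) 1F)) ≡⟨ cong suc IH ⟩
    suc (suc t)                     ∎
    where
    open ≡-Reasoning
    IH = toℕ-β⁺^-1 t (ℕ.<⇒≤ t<1+k)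

  β⁺^-conj : {a b c : Fin (3 + k)} → a ≢ b → a ≢ c → b ≢ c → ∀ t z →
    evalWord (β⁺^ t) (cycle3 a b c (evalWord (β⁻^ t) z))
      ≡ cycle3 (evalWord (β⁺^ t) a) (evalWord (β⁺^ t) b) (evalWord (β⁺^ t) c) z
  β⁺^-conj a≢b a≢c b≢c t z =
    trans (cycle3-map a≢b a≢c b≢c (evalWord (β⁺^ t)) β⁺^-injective (evalWord (β⁻^ t) z))
          (cong (cycle3 _ _ _) (β⁺^-β⁻^ t z))
    where
    β⁺^-injective : ∀ {x y} → evalWord (β⁺^ t) x ≡ evalWord (β⁺^ t) y → x ≡ y
    β⁺^-injective {x} {y} eq = trans (sym (β⁻^-β⁺^ t x)) (trans (cong (evalWord (β⁻^ t)) eq) (β⁻^-β⁺^ t y))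

  corner : ℕ → Fin (3 + k)
  corner j = evalWord (β⁺^ (suc j)) 1F

  toℕ-corner : ∀ j → j ≤ k → toℕ (corner j) ≡ 2 + j
  toℕ-corner j j≤k = toℕ-β⁺^-1 (suc j) (s≤s j≤k)

  ladder : ℕ → List Shift
  ladder zero    = α⁺ ∷ []
  ladder (suc j) = α⁺ ∷ β⁻ ∷ ladder j

  length-ladder : ∀ j → length (ladder j) ≡ suc (j + j)
  length-ladder zero    = refl
  length-ladder (suc j) = cong (λ l → suc (suc l)) (trans (length-ladder j) (sym (ℕ.+-suc j j)))

  -- Conjugating α by β^(j+1) gives (0 cⱼ cⱼ₊₁), which turns (0 1 cⱼ) into (0 1 cⱼ₊₁).
  evalWord-ladder : ∀ j → j ≤ k → ∀ z → evalWord (ladder j) z ≡ evalWord (β⁻^ j) (cycle3 0F 1F (corner j) z)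
  evalWord-ladder zero    _   z = α≗cycle3 k z
  evalWord-ladder (suc j) j<k z = begin
    α k (β⁻¹ k (evalWord (ladder j) z))         ≡⟨ cong (α k ∘ β⁻¹ k) (evalWord-ladder j j≤k z) ⟩
    α k (B⁻ w)                                  ≡⟨ β⁻^-β⁺^ (suc j) (α k (B⁻ w)) ⟨
    B⁻ (B (α k (B⁻ w)))                         ≡⟨ cong (B⁻ ∘ B) (α≗cycle3 k (B⁻ w)) ⟩
    B⁻ (B (cycle3 0F 1F 2F (B⁻ w)))             ≡⟨ cong B⁻ (β⁺^-conj (λ ()) (λ ()) (λ ()) (suc j) w) ⟩
    B⁻ (cycle3 (B 0F) (corner j) (B 2F) w)      ≡⟨ cong₂ (λ a c → B⁻ (cycle3 a (corner j) c w)) (β⁺^-0 (suc j))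
                                                          (evalWord-replicate-comm β⁺ (suc j) 1F) ⟩
    B⁻ (cycle3 0F (corner j) (corner (suc j)) w) ≡⟨ cong B⁻ (cycle3-∘ 0≢1 0≢c 0≢c′ 1≢c 1≢c′ c≢c′ z) ⟩
    B⁻ (cycle3 0F 1F (corner (suc j)) z)        ∎
    where
    open ≡-Reasoning
    j≤k = ℕ.<⇒≤ j<k
    B B⁻ : Fin (3 + k) → Fin (3 + k)
    B  = evalWord (β⁺^ (suc j))
    B⁻ = evalWord (β⁻^ (suc j))
    w  = cycle3 0F 1F (corner j) z
    c≡ = toℕ-corner j j≤k
    c′≡ = toℕ-corner (suc j) j<k
    0≢1 : 0F ≢ 1F
    0≢1 ()
    0≢c = ≢-by-toℕ λ eq → ℕ.0≢1+n (trans eq c≡)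
    0≢c′ = ≢-by-toℕ λ eq → ℕ.0≢1+n (trans eq c′≡)
    1≢c = ≢-by-toℕ λ eq → ℕ.0≢1+n (ℕ.suc-injective (trans eq c≡))
    1≢c′ = ≢-by-toℕ λ eq → ℕ.0≢1+n (ℕ.suc-injective (trans eq c′≡))
    c≢c′ = ≢-by-toℕ λ eq → ℕ.<-irrefl (trans (sym c≡) (trans eq c′≡)) (ℕ.n<1+n (2 + j))

  cycle01-word : ℕ → List Shift
  cycle01-word j = β⁺^ j ++ ladder j

  evalWord-cycle01-word : ∀ j → j ≤ k → ∀ z → evalWord (cycle01-word j) z ≡ cycle3 0F 1F (corner j) z
  evalWord-cycle01-word j j≤k z =
    trans (evalWord-++ (β⁺^ j) (ladder j) z)
          (trans (cong (evalWord (β⁺^ j)) (evalWord-ladder j j≤k z)) (β⁺^-β⁻^ j _))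

  cycle3-word : ℕ → ℕ → List Shift
  cycle3-word s j = β⁺^ s ++ cycle01-word j ++ β⁻^ s

  evalWord-cycle3-word : ∀ s j → j ≤ k → ∀ z →
    evalWord (cycle3-word s j) z ≡ cycle3 0F (evalWord (β⁺^ s) 1F) (evalWord (β⁺^ s) (corner j)) z
  evalWord-cycle3-word s j j≤k z = begin
    evalWord (cycle3-word s j) z                 ≡⟨ evalWord-++ (β⁺^ s) _ z ⟩
    B (evalWord (cycle01-word j ++ β⁻^ s) z)      ≡⟨ cong B (evalWord-++ (cycle01-word j) (β⁻^ s) z) ⟩
    B (evalWord (cycle01-word j) (B⁻ z))          ≡⟨ cong B (evalWord-cycle01-word j j≤k (B⁻ z)) ⟩
    B (cycle3 0F 1F (corner j) (B⁻ z))            ≡⟨ β⁺^-conj (λ ()) 0≢c 1≢c s z ⟩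
    cycle3 (B 0F) (B 1F) (B (corner j)) z         ≡⟨ cong (λ a → cycle3 a (B 1F) (B (corner j)) z) (β⁺^-0 s) ⟩
    cycle3 0F (B 1F) (B (corner j)) z             ∎
    where
    open ≡-Reasoning
    B B⁻ : Fin (3 + k) → Fin (3 + k)
    B  = evalWord (β⁺^ s)
    B⁻ = evalWord (β⁻^ s)
    c≡ = toℕ-corner j j≤k
    0≢c = ≢-by-toℕ λ eq → ℕ.0≢1+n (trans eq c≡)
    1≢c = ≢-by-toℕ λ eq → ℕ.0≢1+n (ℕ.suc-injective (trans eq c≡))

  length-cycle3-word : ∀ s j → length (cycle3-word s j) ≡ s + ((j + suc (j + j)) + s)
  length-cycle3-word s j = begin
    length (β⁺^ s ++ cycle01-word j ++ β⁻^ s)           ≡⟨ length-++ (β⁺^ s) ⟩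
    length (β⁺^ s) + length (cycle01-word j ++ β⁻^ s)    ≡⟨ cong₂ _+_ (length-replicate s) (length-++ (cycle01-word j)) ⟩
    s + (length (cycle01-word j) + length (β⁻^ s))       ≡⟨ cong₂ (λ a b → s + (a + b)) length-cycle01-word (length-replicate s) ⟩
    s + ((j + suc (j + j)) + s)                          ∎
    where
    open ≡-Reasoning
    length-cycle01-word = trans (length-++ (β⁺^ j)) (cong₂ _+_ (length-replicate j) (length-ladder j))

  length-cycle3-word-≤ : ∀ {s j} → s ≤ suc k → j ≤ k → length (cycle3-word s j) ≤ 5 * (3 + k)
  length-cycle3-word-≤ {s} {j} s≤1+k j≤k = begin
    length (cycle3-word s j)                 ≡⟨ length-cycle3-word s j ⟩
    s + ((j + suc (j + j)) + s)              ≤⟨ ℕ.+-mono-≤ s≤1+k (ℕ.+-mono-≤ (ℕ.+-mono-≤ j≤k (s≤s (ℕ.+-mono-≤ j≤k j≤k))) s≤1+k) ⟩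
    suc k + ((k + suc (k + k)) + suc k)      ≤⟨ ℕ.m≤m+n _ 12 ⟩
    suc k + ((k + suc (k + k)) + suc k) + 12 ≡⟨ solve 1 (λ k → (con 1 :+ k) :+ ((k :+ (con 1 :+ (k :+ k))) :+ (con 1 :+ k)) :+ con 12
                                                      := con 5 :* (con 3 :+ k)) refl k ⟩
    5 * (3 + k)                              ∎
    where open ℕ.≤-Reasoning

  -- For x = 1 + s, conjugating by βˢ reduces (0 x y) to (0 1 c) with c = β⁻ˢ y ∉ {0, 1}.
  GeneratedIn-cycle3 : {x y : Fin (3 + k)} (0≢x : 0F ≢ x) (0≢y : 0F ≢ y) (x≢y : x ≢ y) →
                       GeneratedIn k (5 * (3 + k)) (cycle3ₚ 0≢x 0≢y x≢y)
  GeneratedIn-cycle3 {0F}    0≢x _ _ = contradiction refl 0≢x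
  GeneratedIn-cycle3 {suc r} {y} 0≢x 0≢y x≢y = by-preimage (B⁻ y) refl
    where
    s = toℕ r
    s≤1+k : s ≤ suc k
    s≤1+k = s≤s⁻¹ (toℕ<n r)
    B B⁻ : Fin (3 + k) → Fin (3 + k)
    B  = evalWord (β⁺^ s)
    B⁻ = evalWord (β⁻^ s)
    B1≡x : B 1F ≡ suc r
    B1≡x = toℕ-injective (toℕ-β⁺^-1 s s≤1+k)
    y≡B : ∀ {y′} → B⁻ y ≡ y′ → y ≡ B y′
    y≡B eq = trans (sym (β⁺^-β⁻^ s y)) (cong B eq)

    by-preimage : ∀ y′ → B⁻ y ≡ y′ → GeneratedIn k (5 * (3 + k)) (cycle3ₚ 0≢x 0≢y x≢y)
    by-preimage 0F             eq = contradiction (sym (trans (y≡B eq) (β⁺^-0 s))) 0≢y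
    by-preimage 1F             eq = contradiction (sym (trans (y≡B eq) B1≡x)) x≢y
    by-preimage (suc (suc r′)) eq =
      cycle3-word s j , length-cycle3-word-≤ s≤1+k j≤k ,
      λ z → trans (evalWord-cycle3-word s j j≤k z) (cong₂ (λ b c → cycle3 0F b c z) B1≡x Bc≡y)
      where
      j = toℕ r′
      j≤k : j ≤ k
      j≤k = s≤s⁻¹ (toℕ<n r′)
      Bc≡y : B (corner j) ≡ y
      Bc≡y = trans (cong B (toℕ-injective (toℕ-corner j j≤k))) (sym (y≡B eq))

-- Reduction of an even permutation to the identity

module _ {k : ℕ} where

  GeneratedIn-∘ₚ : ∀ {M N} {π ρ : Permutation′ (3 + k)} →
                   GeneratedIn k M π → GeneratedIn k N ρ → GeneratedIn k (N + M) (π ∘ₚ ρ)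
  GeneratedIn-∘ₚ {M} {N} (us , |us|≤M , us≗π) (vs , |vs|≤N , vs≗ρ) =
    vs ++ us ,
    subst (_≤ N + M) (sym (length-++ vs)) (ℕ.+-mono-≤ |vs|≤N |us|≤M) ,
    λ x → trans (evalWord-++ vs us x) (trans (cong (evalWord vs) (us≗π x)) (vs≗ρ _))

  GeneratedIn-mono : ∀ {M N} {σ : Permutation′ (3 + k)} → M ≤ N → GeneratedIn k M σ → GeneratedIn k N σ
  GeneratedIn-mono M≤N (ws , |ws|≤M , ws≗σ) = ws , ℕ.≤-trans |ws|≤M M≤N , ws≗σ

  GeneratedIn-≈ : ∀ {N} {σ τ : Permutation′ (3 + k)} → σ Perm.≈ τ → GeneratedIn k N σ → GeneratedIn k N τ
  GeneratedIn-≈ σ≈τ (ws , |ws|≤N , ws≗σ) = ws , |ws|≤N , λ x → trans (ws≗σ x) (σ≈τ x)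

  module _ (m : ℕ) (IH : ∀ σ → FixesFrom (σ ⟨$⟩ʳ_) (2 + m) → IsEven σ → GeneratedIn k (m * (5 * (3 + k))) σ)
           (σ : Permutation′ (3 + k)) (fix : FixesFrom (σ ⟨$⟩ʳ_) (3 + m)) (even : IsEven σ)
           {p : Fin (3 + k)} (p≡ : toℕ p ≡ 2 + m) where

    private
      FixesFrom-at-p : {f : Fin (3 + k) → Fin (3 + k)} → FixesFrom f (3 + m) → f p ≡ p → FixesFrom f (2 + m)
      FixesFrom-at-p {f} fix-above fp≡p = FixesFrom-extend fix-above λ i i≡ →
        subst (λ j → f j ≡ j) (toℕ-injective (trans p≡ (sym i≡))) fp≡p

      p<3+m : toℕ p < 3 + m
      p<3+m = subst (_< 3 + m) (sym p≡) ℕ.≤-refl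
      0≢p : 0F ≢ p
      0≢p = ≢-by-toℕ λ eq → ℕ.0≢1+n (trans eq p≡)
      p≢1 : p ≢ 1F
      p≢1 = ≢-by-toℕ λ eq → ℕ.0≢1+n (sym (ℕ.suc-injective (trans (sym p≡) eq)))

    fix-by-cycle3 : {b c : Fin (3 + k)} (0≢b : 0F ≢ b) (0≢c : 0F ≢ c) (b≢c : b ≢ c) →
      toℕ b < 3 + m → toℕ c < 3 + m → cycle3 0F b c (σ ⟨$⟩ʳ p) ≡ p →
      GeneratedIn k (suc m * (5 * (3 + k))) σ
    fix-by-cycle3 {b} {c} 0≢b 0≢c b≢c b<3+m c<3+m τσp≡p =
      GeneratedIn-≈ {σ = (σ ∘ₚ τ) ∘ₚ τ⁻¹} {τ = σ} (λ x → cycle3-inverse 0≢b 0≢c b≢c (σ ⟨$⟩ʳ x))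
        (GeneratedIn-∘ₚ {π = σ ∘ₚ τ} {ρ = τ⁻¹} (IH (σ ∘ₚ τ) fix′ even′) (GeneratedIn-cycle3 0≢c 0≢b (≢-sym b≢c)))
      where
      τ τ⁻¹ : Permutation′ (3 + k)
      τ   = cycle3ₚ 0≢b 0≢c b≢c
      τ⁻¹ = cycle3ₚ 0≢c 0≢b (≢-sym b≢c)
      even′ : IsEven (σ ∘ₚ τ)
      even′ = IsEven-∘ₚ σ τ even (IsEven-cube≡id τ (cycle3-cube 0≢b 0≢c b≢c))
      above : ∀ {a i : Fin (3 + k)} → toℕ a < 3 + m → 3 + m ≤ toℕ i → i ≢ a
      above a<3+m 3+m≤i = ≢-by-toℕ λ eq → ℕ.<⇒≱ a<3+m (subst (3 + m ≤_) eq 3+m≤i)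
      fix′ : FixesFrom ((σ ∘ₚ τ) ⟨$⟩ʳ_) (2 + m)
      fix′ = FixesFrom-at-p
        (λ i 3+m≤i → trans (cong (cycle3 0F b c) (fix i 3+m≤i))
                           (cycle3-fix (above (s≤s z≤n) 3+m≤i) (above b<3+m 3+m≤i) (above c<3+m 3+m≤i)))
        τσp≡p

    fix-next-point : GeneratedIn k (suc m * (5 * (3 + k))) σ
    fix-next-point with σ ⟨$⟩ʳ p ≟ p
    ... | yes σp≡p = GeneratedIn-mono {σ = σ} (ℕ.m≤n+m (m * (5 * (3 + k))) (5 * (3 + k)))
                       (IH σ (FixesFrom-at-p fix σp≡p) even)
    ... | no σp≢p with σ ⟨$⟩ʳ p ≟ 0F
    ...   | yes σp≡0 = fix-by-cycle3 0≢p (λ ()) p≢1 p<3+m (s≤s (s≤s z≤n))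
                         (trans (cong (cycle3 0F p 1F) σp≡0) (cycle3-a 0≢p (λ ()) p≢1))
    ...   | no σp≢0  = fix-by-cycle3 (≢-sym σp≢0) 0≢p σp≢p (FixesFrom-< σ fix p<3+m) p<3+m
                         (cycle3-b (≢-sym σp≢0) 0≢p σp≢p)

  IsEven-FixesFrom⇒GeneratedIn : ∀ m → m ≤ suc k → (σ : Permutation′ (3 + k)) → FixesFrom (σ ⟨$⟩ʳ_) (2 + m) →
                                IsEven σ → GeneratedIn k (m * (5 * (3 + k))) σ
  IsEven-FixesFrom⇒GeneratedIn zero    _     σ fix even = [] , z≤n , λ x → sym (IsEven-FixesFrom-2⇒id σ fix even x)
  IsEven-FixesFrom⇒GeneratedIn (suc m) m<1+k σ fix even =
    fix-next-point m (IsEven-FixesFrom⇒GeneratedIn m (ℕ.<⇒≤ m<1+k)) σ fix even {fromℕ< 2+m<3+k} (toℕ-fromℕ< 2+m<3+k)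
    where
    2+m<3+k : 2 + m < 3 + k
    2+m<3+k = s≤s (s≤s m<1+k)

lemma1 : ∃[ C ] (∀ (k : ℕ) (σ : Permutation′ (3 + k)) → IsEven σ →
           GeneratedIn k (C * ((3 + k) * (3 + k))) σ)
lemma1 = 5 , λ k σ even →
  GeneratedIn-mono {k} {σ = σ} (quadratic k)
    (IsEven-FixesFrom⇒GeneratedIn (suc k) ℕ.≤-refl σ (λ i 3+k≤i → contradiction (toℕ<n i) (ℕ.≤⇒≯ 3+k≤i)) even)
  where
  quadratic : ∀ k → suc k * (5 * (3 + k)) ≤ 5 * ((3 + k) * (3 + k))
  quadratic k = begin
    suc k * (5 * (3 + k))       ≤⟨ ℕ.*-monoˡ-≤ (5 * (3 + k)) (ℕ.m≤n+m (suc k) 2) ⟩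
    (3 + k) * (5 * (3 + k))     ≡⟨ solve 1 (λ n → n :* (con 5 :* n) := con 5 :* (n :* n)) refl (3 + k) ⟩
    5 * ((3 + k) * (3 + k))     ∎
    where open ℕ.≤-Reasoning
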